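{- For every integer $d\ge1$ there is a unique polynomial $Q_d(n)$ with rational coefficients such that $|P_n^d|=Q_d(n)$ for all integers $n\ge0$; it has degree $d$, and its coefficient of $n^d$ equals $\dfrac{2^{d-1}}{d!}$.
   Context: For integers $d\ge 1$ and $n\ge 0$, let $e_1,\dots,e_d$ be the standard unit vectors of $\mathbb{Z}^d$ and let $P_n^d=\{X_1+X_2+\cdots+X_n : X_i\in\{\pm e_1,\dots,\pm e_d\}\text{ for } i=1,\dots,n\}\subseteq\mathbb{Z}^d$ be the set of possible positions of a nearest-neighbour walk in $\mathbb{Z}^d$ starting at the origin after exactly $n$ unit steps (so $P_0^d=\{0\}$). $|P_n^d|$ denotes its cardinality. -}

module Defs where

open import Data.Nat as ℕ using (ℕ; zero; suc; _∸_; _^_; _!)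
open import Data.Nat.Properties using (_!≢0)
open import Data.Integer as ℤ using (ℤ; +_; -[1+_])
open import Data.Rational as ℚ using (ℚ; _/_)
open import Data.Fin using (Fin; _≟_)
open import Data.Bool using (Bool; true; false; if_then_else_)
open import Data.Vec as Vec using (Vec; tabulate; replicate; zipWith; foldr)
open import Data.List as List using (List; []; _∷_; length; last)
open import Data.List.Membership.Propositional using (_∈_)
open import Data.List.Relation.Unary.Unique.Propositional using (Unique)
open import Data.Maybe using (Maybe; just; nothing)
open import Data.Product using (Σ; _×_; ∃)
open import Relation.Binary.PropositionalEquality using (_≡_; _≢_)
open import Relation.Nullary using (does)
open import Function.Bundles using (_⇔_)

Point : ℕ → Set
Point d = Vec ℤ d

-- A step ±e_i : direction index i and sign (true = +, false = -).
Step : ℕ → Set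
Step d = Fin d × Bool

stepVec : ∀ {d} → Step d → Point d
stepVec (i Data.Product., s) =
  tabulate λ j → if does (i ≟ j) then (if s then + 1 else -[1+ 0 ]) else + 0

walkEnd : ∀ {d n} → Vec (Step d) n → Point d
walkEnd = foldr _ (λ X acc → zipWith ℤ._+_ (stepVec X) acc) (replicate _ (+ 0))

InP : (d n : ℕ) → Point d → Set
InP d n x = Σ (Vec (Step d) n) λ w → walkEnd w ≡ x

HasCard : ∀ {A : Set} → (A → Set) → ℕ → Set
HasCard {A} S m =
  Σ (List A) λ xs → Unique xs × (∀ x → (x ∈ xs) ⇔ S x) × length xs ≡ m

-- Polynomials over ℚ as coefficient lists, constant term first.
Poly : Set
Poly = List ℚ

-- Canonical form: no trailing zero coefficient (the zero polynomial is []).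
Normalized : Poly → Set
Normalized p = last p ≢ just ℚ.0ℚ

eval : Poly → ℚ → ℚ
eval [] x = ℚ.0ℚ
eval (a ∷ p) x = a ℚ.+ x ℚ.* eval p x

-- Degree of a normalized nonzero polynomial: length - 1.
HasDegree : Poly → ℕ → Set
HasDegree p d = length p ≡ suc d

leadingCoeff : Poly → Maybe ℚ
leadingCoeff = last

toℚ : ℕ → ℚ
toℚ n = + n / 1

CountsWalkPositions : ℕ → Poly → Set
CountsWalkPositions d Q =
  ∀ n → Σ ℕ λ k → HasCard (InP d n) k × toℚ k ≡ eval Q (toℚ n)

leadTarget : ℕ → ℚ
leadTarget d = (+ (2 ^ (d ∸ 1))) / (d !)
  where instance _ = d !≢0

{-# OPTIONS --safe #-}
module Submission where

-- A point of ℤ^d (d ≥ 1) is the end of an n-step walk iff its ℓ¹-norm is at most n and has the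
-- parity of n: every step changes the norm by one, and surplus steps can be spent going back
-- and forth along an axis. Splitting off the first coordinate gives
-- |P_n^(d+1)| = |P_n^d| + 2 Σ_{m<n} |P_m^d|, starting from |P_n^1| = n + 1. In the basis of
-- the binomial polynomials (n choose j), summation over m < n is the shift j ↦ j + 1 (hockey
-- stick), so the coordinates of |P_n^(d+1)| are the coefficients of (1 + z) (1 + 2z)^d. The top
-- one, 2^d, multiplies (n choose d + 1), whose leading coefficient is 1 / (d + 1)!. Uniqueness
-- holds because a polynomial vanishing at every natural number has only zero coefficients.

open import Defs
open import Data.Bool using (Bool; true; false)
open import Data.Empty using (⊥; ⊥-elim)
open import Data.Fin using (Fin)
open import Data.Integer as ℤ using (ℤ; -[1+_]; ∣_∣)
import Data.Integer.Properties as ℤ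
open import Data.List as List using (List; []; _∷_; _++_; length; last)
open import Data.List.Membership.Propositional using (_∈_)
open import Data.List.Membership.Propositional.Properties using (∈-map⁺; ∈-map⁻; ∈-++⁺ˡ; ∈-++⁺ʳ; ∈-++⁻)
open import Data.List.Membership.Propositional.Properties.WithK using (unique∧set⇒bag)
open import Data.List.Properties using (length-++; length-map; last-map)
open import Data.List.Relation.Binary.BagAndSetEquality using (∼bag⇒↭)
open import Data.List.Relation.Binary.Permutation.Propositional.Properties using (↭-length)
open import Data.List.Relation.Unary.All as All using (All; []; _∷_)
import Data.List.Relation.Unary.All.Properties as All
open import Data.List.Relation.Unary.AllPairs using ([]; _∷_)
open import Data.List.Relation.Unary.Any using (here; there)
open import Data.List.Relation.Unary.Unique.Propositional using (Unique)
import Data.List.Relation.Unary.Unique.Propositional.Properties as Unique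
open import Data.Maybe as Maybe using (just)
open import Data.Maybe.Properties using (just-injective)
open import Data.Nat as ℕ using (ℕ; zero; suc; _≤_; _<_; _≥_; s≤s; z≤n; _∸_; _^_; _!)
import Data.Nat.Coprimality as Coprime
import Data.Nat.Properties as ℕ
open import Data.Nat.Tactic.RingSolver using () renaming (ring to ℕ-ring)
open import Data.Product using (Σ; _×_; _,_; proj₁)
open import Data.Rational as ℚ using (ℚ; mkℚ; 0ℚ; 1ℚ; _+_; _*_; -_; _-_; 1/_; _/_)
import Data.Rational.Properties as ℚ
open import Data.Sum using (_⊎_; inj₁; inj₂)
open import Data.Vec as Vec using (Vec; []; _∷_; replicate; zipWith)
open import Data.Vec.Properties using (zipWith-assoc; zipWith-identityˡ; zipWith-identityʳ; tabulate-cong; tabulate∘lookup; lookup-replicate)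
open import Function.Bundles using (mk⇔)
import Function.Properties.Equivalence as ⇔
open import Level using (0ℓ)
open import Relation.Binary.PropositionalEquality
open import Relation.Nullary.Decidable using (dec⇒maybe)
open import Tactic.RingSolver using (solve-∀)
open import Tactic.RingSolver.Core.AlmostCommutativeRing using (AlmostCommutativeRing; fromCommutativeRing)

open ≡-Reasoning

ℚ-ring : AlmostCommutativeRing 0ℓ 0ℓ
ℚ-ring = fromCommutativeRing ℚ.+-*-commutativeRing (λ x → dec⇒maybe (0ℚ ℚ.≟ x))

-- toℚ n in normal form, so that its numerator is definitionally + n
toℚ′ : ℕ → ℚ
toℚ′ n = mkℚ (ℤ.+ n) 0 (Coprime.sym (Coprime.1-coprimeTo n))

toℚ≡toℚ′ : ∀ n → toℚ n ≡ toℚ′ n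
toℚ≡toℚ′ n = ℚ.↥p/↧p≡p (toℚ′ n)

toℚ-+ : ∀ m n → toℚ (m ℕ.+ n) ≡ toℚ m + toℚ n
toℚ-+ m n rewrite toℚ≡toℚ′ m | toℚ≡toℚ′ n =
  ℚ./-cong (sym (cong₂ ℤ._+_ (ℤ.*-identityʳ (ℤ.+ m)) (ℤ.*-identityʳ (ℤ.+ n)))) refl

toℚ-* : ∀ m n → toℚ (m ℕ.* n) ≡ toℚ m * toℚ n
toℚ-* m n rewrite toℚ≡toℚ′ m | toℚ≡toℚ′ n = ℚ./-cong (ℤ.pos-* m n) refl

toℚ-suc : ∀ n → toℚ (suc n) ≡ 1ℚ + toℚ n
toℚ-suc n = toℚ-+ 1 n

toℚ-≢0 : ∀ {n} → n ≢ 0 → toℚ n ≢ 0ℚ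
toℚ-≢0 {n} n≢0 toℚn≡0 = n≢0 (ℤ.+-injective (cong ℚ.↥_ (trans (sym (toℚ≡toℚ′ n)) toℚn≡0)))

recipSuc : ℕ → ℚ
recipSuc n = 1/ toℚ′ (suc n)

recipSuc-inverseʳ : ∀ n → toℚ (suc n) * recipSuc n ≡ 1ℚ
recipSuc-inverseʳ n rewrite toℚ≡toℚ′ (suc n) = ℚ.*-inverseʳ (toℚ′ (suc n))

recipSuc-inverseˡ : ∀ n → recipSuc n * toℚ (suc n) ≡ 1ℚ
recipSuc-inverseˡ n = trans (ℚ.*-comm (recipSuc n) (toℚ (suc n))) (recipSuc-inverseʳ n)

*-cancelˡ-toℚ-suc : ∀ n {a b} → toℚ (suc n) * a ≡ toℚ (suc n) * b → a ≡ b
*-cancelˡ-toℚ-suc n {a} {b} eq = begin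
  a                                     ≡⟨ sym (undo a) ⟩
  recipSuc n * (toℚ (suc n) * a)        ≡⟨ cong (recipSuc n *_) eq ⟩
  recipSuc n * (toℚ (suc n) * b)        ≡⟨ undo b ⟩
  b                                     ∎
  where
  undo : ∀ y → recipSuc n * (toℚ (suc n) * y) ≡ y
  undo y = trans (sym (ℚ.*-assoc (recipSuc n) (toℚ (suc n)) y))
    (trans (cong (_* y) (recipSuc-inverseˡ n)) (ℚ.*-identityˡ y))

-- Polynomials as coefficient lists

infixl 6 _⊕_ _⊖_

_⊕_ : Poly → Poly → Poly
[] ⊕ q = q
(a ∷ p) ⊕ [] = a ∷ p
(a ∷ p) ⊕ (b ∷ q) = (a + b) ∷ (p ⊕ q)

_⊖_ : Poly → Poly → Poly
p ⊖ q = p ⊕ List.map -_ q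

scale : ℚ → Poly → Poly
scale c = List.map (c *_)

⊕-identityʳ : ∀ p → p ⊕ [] ≡ p
⊕-identityʳ [] = refl
⊕-identityʳ (a ∷ p) = refl

eval-⊕ : ∀ p q x → eval (p ⊕ q) x ≡ eval p x + eval q x
eval-⊕ [] q x = sym (ℚ.+-identityˡ _)
eval-⊕ (a ∷ p) [] x = sym (ℚ.+-identityʳ _)
eval-⊕ (a ∷ p) (b ∷ q) x = begin
  (a + b) + x * eval (p ⊕ q) x          ≡⟨ cong (λ v → (a + b) + x * v) (eval-⊕ p q x) ⟩
  (a + b) + x * (eval p x + eval q x)   ≡⟨ lemma a b x (eval p x) (eval q x) ⟩
  (a + x * eval p x) + (b + x * eval q x) ∎
  where
  lemma : ∀ a b x u v → (a + b) + x * (u + v) ≡ (a + x * u) + (b + x * v)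
  lemma = solve-∀ ℚ-ring

eval-scale : ∀ c p x → eval (scale c p) x ≡ c * eval p x
eval-scale c [] x = sym (ℚ.*-zeroʳ c)
eval-scale c (a ∷ p) x = begin
  c * a + x * eval (scale c p) x  ≡⟨ cong (λ v → c * a + x * v) (eval-scale c p x) ⟩
  c * a + x * (c * eval p x)      ≡⟨ lemma c a x (eval p x) ⟩
  c * (a + x * eval p x)          ∎
  where
  lemma : ∀ c a x u → c * a + x * (c * u) ≡ c * (a + x * u)
  lemma = solve-∀ ℚ-ring

eval-neg : ∀ p x → eval (List.map -_ p) x ≡ - eval p x
eval-neg [] x = refl
eval-neg (a ∷ p) x = begin
  - a + x * eval (List.map -_ p) x ≡⟨ cong (λ v → - a + x * v) (eval-neg p x) ⟩
  - a + x * - eval p x             ≡⟨ lemma a x (eval p x) ⟩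
  - (a + x * eval p x)             ∎
  where
  lemma : ∀ a x u → - a + x * - u ≡ - (a + x * u)
  lemma = solve-∀ ℚ-ring

eval-⊖ : ∀ p q x → eval (p ⊖ q) x ≡ eval p x - eval q x
eval-⊖ p q x = trans (eval-⊕ p (List.map -_ q) x) (cong (λ v → eval p x + v) (eval-neg q x))

eval-0∷ : ∀ p x → eval (0ℚ ∷ p) x ≡ x * eval p x
eval-0∷ p x = ℚ.+-identityˡ _

length-⊕ : ∀ p q → length p ≤ length q → length (p ⊕ q) ≡ length q
length-⊕ [] q _ = refl
length-⊕ (a ∷ p) (b ∷ q) (s≤s le) = cong suc (length-⊕ p q le)

last-⊕ : ∀ p q → length p < length q → last (p ⊕ q) ≡ last q
last-⊕ [] q _ = refl
last-⊕ (a ∷ []) (b ∷ []) (s≤s ())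
last-⊕ (a ∷ []) (b ∷ c ∷ q) _ = refl
last-⊕ (a ∷ a′ ∷ p) (b ∷ []) (s≤s ())
last-⊕ (a ∷ a′ ∷ p) (b ∷ b′ ∷ q) (s≤s lt) = last-⊕ (a′ ∷ p) (b′ ∷ q) lt

infixl 7 _*[X-_]

_*[X-_] : Poly → ℚ → Poly
p *[X- c ] = scale (- c) p ⊕ (0ℚ ∷ p)

eval-*[X-] : ∀ p c x → eval (p *[X- c ]) x ≡ eval p x * (x - c)
eval-*[X-] p c x = begin
  eval (scale (- c) p ⊕ (0ℚ ∷ p)) x           ≡⟨ eval-⊕ (scale (- c) p) (0ℚ ∷ p) x ⟩
  eval (scale (- c) p) x + eval (0ℚ ∷ p) x    ≡⟨ cong₂ _+_ (eval-scale (- c) p x) (eval-0∷ p x) ⟩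
  - c * eval p x + x * eval p x               ≡⟨ lemma c x (eval p x) ⟩
  eval p x * (x - c)                          ∎
  where
  lemma : ∀ c x u → - c * u + x * u ≡ u * (x - c)
  lemma = solve-∀ ℚ-ring

length-*[X-] : ∀ p c → length (p *[X- c ]) ≡ suc (length p)
length-*[X-] p c = length-⊕ (scale (- c) p) (0ℚ ∷ p) (ℕ.m≤n⇒m≤1+n (ℕ.≤-reflexive (length-map (- c *_) p)))

last-*[X-] : ∀ a p c → last ((a ∷ p) *[X- c ]) ≡ last (a ∷ p)
last-*[X-] a p c =
  last-⊕ (scale (- c) (a ∷ p)) (0ℚ ∷ a ∷ p) (s≤s (ℕ.≤-reflexive (length-map (- c *_) (a ∷ p))))

-- A polynomial is determined by its values at the naturals

AllZero : Poly → Set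
AllZero = All (_≡ 0ℚ)

eval-AllZero : ∀ {p} x → AllZero p → eval p x ≡ 0ℚ
eval-AllZero x [] = refl
eval-AllZero {a ∷ p} x (a≡0 ∷ p≡0) = begin
  a + x * eval p x  ≡⟨ cong₂ (λ u v → u + x * v) a≡0 (eval-AllZero x p≡0) ⟩
  0ℚ + x * 0ℚ       ≡⟨ lemma x ⟩
  0ℚ                ∎
  where
  lemma : ∀ x → 0ℚ + x * 0ℚ ≡ 0ℚ
  lemma = solve-∀ ℚ-ring

quotient : ℚ → Poly → Poly
quotient s [] = []
quotient s (a ∷ []) = []
quotient s (a ∷ p@(_ ∷ _)) = eval p s ∷ quotient s p

eval-quotient : ∀ s p x → eval p x - eval p s ≡ (x - s) * eval (quotient s p) x
eval-quotient s [] x = lemma x s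
  where
  lemma : ∀ x s → 0ℚ - 0ℚ ≡ (x - s) * 0ℚ
  lemma = solve-∀ ℚ-ring
eval-quotient s (a ∷ []) x = lemma a x s
  where
  lemma : ∀ a x s → (a + x * 0ℚ) - (a + s * 0ℚ) ≡ (x - s) * 0ℚ
  lemma = solve-∀ ℚ-ring
eval-quotient s (a ∷ p@(_ ∷ _)) x = begin
  (a + x * eval p x) - (a + s * eval p s)
    ≡⟨ lemma a x s (eval p x) (eval p s) ⟩
  (x - s) * eval p s + x * (eval p x - eval p s)
    ≡⟨ cong (λ v → (x - s) * eval p s + x * v) (eval-quotient s p x) ⟩
  (x - s) * eval p s + x * ((x - s) * eval q x)
    ≡⟨ lemma′ x s (eval p s) (eval q x) ⟩
  (x - s) * (eval p s + x * eval q x)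
    ∎
  where
  q = quotient s p
  lemma : ∀ a x s u v → (a + x * u) - (a + s * v) ≡ (x - s) * v + x * (u - v)
  lemma = solve-∀ ℚ-ring
  lemma′ : ∀ x s v w → (x - s) * v + x * ((x - s) * w) ≡ (x - s) * (v + x * w)
  lemma′ = solve-∀ ℚ-ring

length-quotient : ∀ s a p → length (quotient s (a ∷ p)) ≡ length p
length-quotient s a [] = refl
length-quotient s a (b ∷ p) = cong suc (length-quotient s b p)

AllZero-∷ : ∀ {a p} s → AllZero p → eval (a ∷ p) s ≡ 0ℚ → AllZero (a ∷ p)
AllZero-∷ {a} {p} s p≡0 a∷p[s]≡0 = a≡0 ∷ p≡0
  where
  a≡0 : a ≡ 0ℚ
  a≡0 = begin
    a                  ≡⟨ ℚ.+-identityʳ a ⟨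
    a + 0ℚ             ≡⟨ cong (a +_) (ℚ.*-zeroʳ s) ⟨
    a + s * 0ℚ         ≡⟨ cong (λ v → a + s * v) (eval-AllZero s p≡0) ⟨
    a + s * eval p s   ≡⟨ a∷p[s]≡0 ⟩
    0ℚ                 ∎

AllZero-quotient : ∀ s a p → AllZero (quotient s (a ∷ p)) → AllZero p
AllZero-quotient s a [] _ = []
AllZero-quotient s a (b ∷ p) (p[s]≡0 ∷ q≡0) = AllZero-∷ s (AllZero-quotient s b p q≡0) p[s]≡0

-- Dividing by x - s leaves a shorter polynomial vanishing at s + 1, s + 2, ….
vanishing⇒AllZero : ∀ p s → (∀ n → eval p (toℚ (s ℕ.+ n)) ≡ 0ℚ) → AllZero p
vanishing⇒AllZero f = go (length f) f refl
  where
  go : ∀ L p → length p ≡ L → ∀ s → (∀ n → eval p (toℚ (s ℕ.+ n)) ≡ 0ℚ) → AllZero p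
  go _ [] _ s vanish = []
  go (suc L) (a ∷ r) len s vanish = AllZero-∷ σ r≡0 p[σ]≡0
    where
    p = a ∷ r
    σ = toℚ s
    p[σ]≡0 : eval p σ ≡ 0ℚ
    p[σ]≡0 = subst (λ m → eval p (toℚ m) ≡ 0ℚ) (ℕ.+-identityʳ s) (vanish 0)
    q = quotient σ p
    q-vanish : ∀ n → eval q (toℚ (suc s ℕ.+ n)) ≡ 0ℚ
    q-vanish n = *-cancelˡ-toℚ-suc n (begin
      toℚ (suc n) * eval q x          ≡⟨ cong (_* eval q x) x-σ≡1+n ⟨
      (x - σ) * eval q x              ≡⟨ eval-quotient σ p x ⟨
      eval p x - eval p σ             ≡⟨ cong₂ _-_ p[x]≡0 p[σ]≡0 ⟩
      0ℚ - 0ℚ                         ≡⟨ ℚ.*-zeroʳ (toℚ (suc n)) ⟨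
      toℚ (suc n) * 0ℚ                ∎)
      where
      x = toℚ (suc s ℕ.+ n)
      p[x]≡0 : eval p x ≡ 0ℚ
      p[x]≡0 = subst (λ m → eval p (toℚ m) ≡ 0ℚ) (ℕ.+-suc s n) (vanish (suc n))
      x-σ≡1+n : x - σ ≡ toℚ (suc n)
      x-σ≡1+n = begin
        toℚ (suc s ℕ.+ n) - σ
          ≡⟨ cong (_- σ) (trans (cong toℚ (sym (ℕ.+-suc s n))) (toℚ-+ s (suc n))) ⟩
        (σ + toℚ (suc n)) - σ
          ≡⟨ lemma σ (toℚ (suc n)) ⟩
        toℚ (suc n)
          ∎
        where
        lemma : ∀ a b → (a + b) - a ≡ b
        lemma = solve-∀ ℚ-ring
    r≡0 : AllZero r
    r≡0 = AllZero-quotient σ a r (go L q (trans (length-quotient σ a r) (ℕ.suc-injective len)) (suc s) q-vanish)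

last-AllZero : ∀ a p → AllZero (a ∷ p) → last (a ∷ p) ≡ just 0ℚ
last-AllZero a [] (a≡0 ∷ []) = cong just a≡0
last-AllZero a (b ∷ p) (_ ∷ p≡0) = last-AllZero b p p≡0

Normalized-tail : ∀ a p → Normalized (a ∷ p) → Normalized p
Normalized-tail a [] _ ()
Normalized-tail a (b ∷ p) norm = norm

AllZero-⊖⇒≡ : ∀ p q → Normalized p → Normalized q → AllZero (p ⊖ q) → p ≡ q
AllZero-⊖⇒≡ [] [] _ _ _ = refl
AllZero-⊖⇒≡ [] (b ∷ q) _ norm-q p⊖q≡0 =
  ⊥-elim (norm-q (last-AllZero b q (All.map ℚ.neg-injective (All.map⁻ p⊖q≡0))))
AllZero-⊖⇒≡ (a ∷ p) [] norm-p _ p⊖q≡0 = ⊥-elim (norm-p (last-AllZero a p p⊖q≡0))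
AllZero-⊖⇒≡ (a ∷ p) (b ∷ q) norm-p norm-q (a-b≡0 ∷ p⊖q≡0) =
  cong₂ _∷_ a≡b (AllZero-⊖⇒≡ p q (Normalized-tail a p norm-p) (Normalized-tail b q norm-q) p⊖q≡0)
  where
  a≡b : a ≡ b
  a≡b = begin
    a                ≡⟨ lemma a b ⟩
    (a - b) + b      ≡⟨ cong (_+ b) a-b≡0 ⟩
    0ℚ + b           ≡⟨ ℚ.+-identityˡ b ⟩
    b                ∎
    where
    lemma : ∀ a b → a ≡ (a - b) + b
    lemma = solve-∀ ℚ-ring

Normalized-eval-injective : ∀ p q → Normalized p → Normalized q →
                            (∀ n → eval p (toℚ n) ≡ eval q (toℚ n)) → p ≡ q
Normalized-eval-injective p q norm-p norm-q p≗q =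
  AllZero-⊖⇒≡ p q norm-p norm-q (vanishing⇒AllZero (p ⊖ q) 0 vanish)
  where
  vanish : ∀ n → eval (p ⊖ q) (toℚ n) ≡ 0ℚ
  vanish n = begin
    eval (p ⊖ q) (toℚ n)                 ≡⟨ eval-⊖ p q (toℚ n) ⟩
    eval p (toℚ n) - eval q (toℚ n)      ≡⟨ cong (_- eval q (toℚ n)) (p≗q n) ⟩
    eval q (toℚ n) - eval q (toℚ n)      ≡⟨ ℚ.+-inverseʳ (eval q (toℚ n)) ⟩
    0ℚ                                   ∎

-- Binomial polynomials

-- x ↦ (x choose k) = x (x - 1) ⋯ (x - k + 1) / k!
binomial : ℕ → Poly
binomial zero = 1ℚ ∷ []
binomial (suc k) = scale (recipSuc k) (binomial k *[X- toℚ k ])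

eval-binomial-zero : ∀ x → eval (binomial zero) x ≡ 1ℚ
eval-binomial-zero x = lemma x
  where
  lemma : ∀ x → 1ℚ + x * 0ℚ ≡ 1ℚ
  lemma = solve-∀ ℚ-ring

eval-binomial-suc : ∀ k x → toℚ (suc k) * eval (binomial (suc k)) x ≡ eval (binomial k) x * (x - toℚ k)
eval-binomial-suc k x = begin
  toℚ (suc k) * eval (binomial (suc k)) x
    ≡⟨ cong (toℚ (suc k) *_) (eval-scale (recipSuc k) (binomial k *[X- toℚ k ]) x) ⟩
  toℚ (suc k) * (recipSuc k * y)
    ≡⟨ ℚ.*-assoc (toℚ (suc k)) (recipSuc k) y ⟨
  (toℚ (suc k) * recipSuc k) * y
    ≡⟨ cong (_* y) (recipSuc-inverseʳ k) ⟩
  1ℚ * y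
    ≡⟨ ℚ.*-identityˡ y ⟩
  y
    ≡⟨ eval-*[X-] (binomial k) (toℚ k) x ⟩
  eval (binomial k) x * (x - toℚ k)
    ∎
  where y = eval (binomial k *[X- toℚ k ]) x

eval-binomial-suc-0ℚ : ∀ k → eval (binomial (suc k)) 0ℚ ≡ 0ℚ
eval-binomial-suc-0ℚ k = *-cancelˡ-toℚ-suc k (begin
  toℚ (suc k) * eval (binomial (suc k)) 0ℚ       ≡⟨ eval-binomial-suc k 0ℚ ⟩
  eval (binomial k) 0ℚ * (0ℚ - toℚ k)            ≡⟨ lower-factor-zero k ⟩
  0ℚ                                             ≡⟨ ℚ.*-zeroʳ (toℚ (suc k)) ⟨
  toℚ (suc k) * 0ℚ                               ∎)
  where
  lower-factor-zero : ∀ k → eval (binomial k) 0ℚ * (0ℚ - toℚ k) ≡ 0ℚ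
  lower-factor-zero zero = refl
  lower-factor-zero (suc k) =
    trans (cong (_* (0ℚ - toℚ (suc k))) (eval-binomial-suc-0ℚ k)) (ℚ.*-zeroˡ (0ℚ - toℚ (suc k)))

-- Multiplied by k + 1, both sides become (x choose k) (x + 1).
binomial-pascal : ∀ k x → eval (binomial (suc k)) (x + 1ℚ) ≡ eval (binomial (suc k)) x + eval (binomial k) x
binomial-pascal zero x = *-cancelˡ-toℚ-suc 0 (begin
  1ℚ * eval (binomial 1) (x + 1ℚ)
    ≡⟨ eval-binomial-suc 0 (x + 1ℚ) ⟩
  eval (binomial 0) (x + 1ℚ) * (x + 1ℚ - 0ℚ)
    ≡⟨ cong (_* (x + 1ℚ - 0ℚ)) (eval-binomial-zero (x + 1ℚ)) ⟩
  1ℚ * (x + 1ℚ - 0ℚ)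
    ≡⟨ lemma x ⟩
  1ℚ * (x - 0ℚ) + 1ℚ * 1ℚ
    ≡⟨ cong₂ (λ u v → u * (x - 0ℚ) + 1ℚ * v) (eval-binomial-zero x) (eval-binomial-zero x) ⟨
  B * (x - 0ℚ) + 1ℚ * B
    ≡⟨ cong (_+ 1ℚ * B) (eval-binomial-suc 0 x) ⟨
  1ℚ * A + 1ℚ * B
    ≡⟨ ℚ.*-distribˡ-+ 1ℚ A B ⟨
  1ℚ * (A + B)
    ∎)
  where
  A = eval (binomial 1) x
  B = eval (binomial 0) x
  lemma : ∀ x → 1ℚ * (x + 1ℚ - 0ℚ) ≡ 1ℚ * (x - 0ℚ) + 1ℚ * 1ℚ
  lemma = solve-∀ ℚ-ring
binomial-pascal (suc k) x = *-cancelˡ-toℚ-suc (suc k) (begin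
  toℚ (2 ℕ.+ k) * eval (binomial (2 ℕ.+ k)) (x + 1ℚ)
    ≡⟨ eval-binomial-suc (suc k) (x + 1ℚ) ⟩
  eval (binomial (suc k)) (x + 1ℚ) * (x + 1ℚ - toℚ (suc k))
    ≡⟨ cong₂ (λ u v → u * (x + 1ℚ - v)) (binomial-pascal k x) (toℚ-suc k) ⟩
  (A + B) * (x + 1ℚ - (1ℚ + K))
    ≡⟨ lemma A B x K ⟩
  A * (x - K) + B * (x - K)
    ≡⟨ cong (A * (x - K) +_) (eval-binomial-suc k x) ⟨
  A * (x - K) + toℚ (suc k) * A
    ≡⟨ cong (λ v → A * (x - K) + v * A) (toℚ-suc k) ⟩
  A * (x - K) + (1ℚ + K) * A
    ≡⟨ lemma′ A x K ⟩
  A * (x - (1ℚ + K)) + (1ℚ + (1ℚ + K)) * A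
    ≡⟨ cong₂ (λ u v → A * (x - u) + v * A) (toℚ-suc k) (trans (toℚ-suc (suc k)) (cong (1ℚ +_) (toℚ-suc k))) ⟨
  A * (x - toℚ (suc k)) + toℚ (2 ℕ.+ k) * A
    ≡⟨ cong (_+ toℚ (2 ℕ.+ k) * A) (eval-binomial-suc (suc k) x) ⟨
  toℚ (2 ℕ.+ k) * eval (binomial (2 ℕ.+ k)) x + toℚ (2 ℕ.+ k) * A
    ≡⟨ ℚ.*-distribˡ-+ (toℚ (2 ℕ.+ k)) _ A ⟨
  toℚ (2 ℕ.+ k) * (eval (binomial (2 ℕ.+ k)) x + A)
    ∎)
  where
  A = eval (binomial (suc k)) x
  B = eval (binomial k) x
  K = toℚ k
  lemma : ∀ A B x K → (A + B) * (x + 1ℚ - (1ℚ + K)) ≡ A * (x - K) + B * (x - K)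
  lemma = solve-∀ ℚ-ring
  lemma′ : ∀ A x K → A * (x - K) + (1ℚ + K) * A ≡ A * (x - (1ℚ + K)) + (1ℚ + (1ℚ + K)) * A
  lemma′ = solve-∀ ℚ-ring

length-binomial : ∀ k → length (binomial k) ≡ suc k
length-binomial zero = refl
length-binomial (suc k) = begin
  length (scale (recipSuc k) (binomial k *[X- toℚ k ]))
    ≡⟨ length-map (recipSuc k *_) (binomial k *[X- toℚ k ]) ⟩
  length (binomial k *[X- toℚ k ])
    ≡⟨ length-*[X-] (binomial k) (toℚ k) ⟩
  suc (length (binomial k))
    ≡⟨ cong suc (length-binomial k) ⟩
  suc (suc k)
    ∎

binomialLead : ℕ → ℚ
binomialLead zero = 1ℚ
binomialLead (suc k) = recipSuc k * binomialLead k

last-binomial : ∀ k → last (binomial k) ≡ just (binomialLead k)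
last-binomial zero = refl
last-binomial (suc k) with binomial k | last-binomial k
... | a ∷ p | last≡lead = begin
  last (scale (recipSuc k) ((a ∷ p) *[X- toℚ k ]))
    ≡⟨ last-map (recipSuc k *_) ((a ∷ p) *[X- toℚ k ]) ⟩
  Maybe.map (recipSuc k *_) (last ((a ∷ p) *[X- toℚ k ]))
    ≡⟨ cong (Maybe.map (recipSuc k *_)) (trans (last-*[X-] a p (toℚ k)) last≡lead) ⟩
  just (recipSuc k * binomialLead k)
    ∎

binomialLead-* : ∀ k → binomialLead k * toℚ (k !) ≡ 1ℚ
binomialLead-* zero = refl
binomialLead-* (suc k) = begin
  (r * lead) * toℚ (suc k ℕ.* k !)           ≡⟨ cong ((r * lead) *_) (toℚ-* (suc k) (k !)) ⟩
  (r * lead) * (toℚ (suc k) * toℚ (k !))     ≡⟨ lemma r lead (toℚ (suc k)) (toℚ (k !)) ⟩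
  (r * toℚ (suc k)) * (lead * toℚ (k !))     ≡⟨ cong₂ _*_ (recipSuc-inverseˡ k) (binomialLead-* k) ⟩
  1ℚ                                         ∎
  where
  r = recipSuc k
  lead = binomialLead k
  lemma : ∀ a b c d → (a * b) * (c * d) ≡ (a * c) * (b * d)
  lemma = solve-∀ ℚ-ring

*-binomialLead-≢0 : ∀ {a} k → a ≢ 0ℚ → a * binomialLead k ≢ 0ℚ
*-binomialLead-≢0 {a} k a≢0 a*lead≡0 = a≢0 (begin
  a                                   ≡⟨ ℚ.*-identityʳ a ⟨
  a * 1ℚ                              ≡⟨ cong (a *_) (binomialLead-* k) ⟨
  a * (binomialLead k * toℚ (k !))  ≡⟨ ℚ.*-assoc a (binomialLead k) (toℚ (k !)) ⟨
  (a * binomialLead k) * toℚ (k !)  ≡⟨ cong (_* toℚ (k !)) a*lead≡0 ⟩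
  0ℚ * toℚ (k !)                    ≡⟨ ℚ.*-zeroˡ (toℚ (k !)) ⟩
  0ℚ                                  ∎)

toℚ-*-binomialLead : ∀ a k → toℚ a * binomialLead k ≡ ((ℤ.+ a) / (k !)) {{k ℕ.!≢0}}
toℚ-*-binomialLead a k with k ! | binomialLead-* k | k ℕ.!≢0
... | suc m | lead*m≡1 | _ = begin
  toℚ a * lead                                  ≡⟨ cong (toℚ a *_) lead≡recip ⟩
  toℚ a * recipSuc m                            ≡⟨ cong (_* recipSuc m) (toℚ≡toℚ′ a) ⟩
  toℚ′ a * recipSuc m                           ≡⟨ ℚ./-cong (ℤ.*-identityʳ (ℤ.+ a)) (ℕ.*-identityˡ (suc m)) ⟩
  ℤ.+ a / suc m                                 ∎
  where
  lead = binomialLead k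
  lead≡recip : lead ≡ recipSuc m
  lead≡recip = begin
    lead                                 ≡⟨ ℚ.*-identityʳ lead ⟨
    lead * 1ℚ                            ≡⟨ cong (lead *_) (recipSuc-inverseʳ m) ⟨
    lead * (toℚ (suc m) * recipSuc m)    ≡⟨ ℚ.*-assoc lead (toℚ (suc m)) (recipSuc m) ⟨
    (lead * toℚ (suc m)) * recipSuc m    ≡⟨ cong (_* recipSuc m) lead*m≡1 ⟩
    1ℚ * recipSuc m                      ≡⟨ ℚ.*-identityˡ (recipSuc m) ⟩
    recipSuc m                           ∎

-- Binomial coordinates

-- Σⱼ cⱼ (x choose k + j)
fromBinomial : ℕ → List ℚ → Poly
fromBinomial k [] = []
fromBinomial k (c ∷ cs) = scale c (binomial k) ⊕ fromBinomial (suc k) cs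

eval-fromBinomial-∷ : ∀ k c cs x →
  eval (fromBinomial k (c ∷ cs)) x ≡ c * eval (binomial k) x + eval (fromBinomial (suc k) cs) x
eval-fromBinomial-∷ k c cs x =
  trans (eval-⊕ (scale c (binomial k)) _ x) (cong (_+ _) (eval-scale c (binomial k) x))

fromBinomial-pascal : ∀ k cs x →
  eval (fromBinomial (suc k) cs) (x + 1ℚ) ≡ eval (fromBinomial (suc k) cs) x + eval (fromBinomial k cs) x
fromBinomial-pascal k [] x = refl
fromBinomial-pascal k (c ∷ cs) x = begin
  eval (fromBinomial (suc k) (c ∷ cs)) (x + 1ℚ)
    ≡⟨ eval-fromBinomial-∷ (suc k) c cs (x + 1ℚ) ⟩
  c * eval (binomial (suc k)) (x + 1ℚ) + eval (fromBinomial (2 ℕ.+ k) cs) (x + 1ℚ)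
    ≡⟨ cong₂ (λ u v → c * u + v) (binomial-pascal k x) (fromBinomial-pascal (suc k) cs x) ⟩
  c * (A′ + A) + (B′ + B)
    ≡⟨ lemma c A′ A B′ B ⟩
  (c * A′ + B′) + (c * A + B)
    ≡⟨ cong₂ _+_ (eval-fromBinomial-∷ (suc k) c cs x) (eval-fromBinomial-∷ k c cs x) ⟨
  eval (fromBinomial (suc k) (c ∷ cs)) x + eval (fromBinomial k (c ∷ cs)) x
    ∎
  where
  A′ = eval (binomial (suc k)) x
  A = eval (binomial k) x
  B′ = eval (fromBinomial (2 ℕ.+ k) cs) x
  B = eval (fromBinomial (suc k) cs) x
  lemma : ∀ c a′ a b′ b → c * (a′ + a) + (b′ + b) ≡ (c * a′ + b′) + (c * a + b)
  lemma = solve-∀ ℚ-ring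

eval-fromBinomial-suc-0ℚ : ∀ k cs → eval (fromBinomial (suc k) cs) 0ℚ ≡ 0ℚ
eval-fromBinomial-suc-0ℚ k [] = refl
eval-fromBinomial-suc-0ℚ k (c ∷ cs) = begin
  eval (fromBinomial (suc k) (c ∷ cs)) 0ℚ
    ≡⟨ eval-fromBinomial-∷ (suc k) c cs 0ℚ ⟩
  c * eval (binomial (suc k)) 0ℚ + eval (fromBinomial (2 ℕ.+ k) cs) 0ℚ
    ≡⟨ cong₂ (λ u v → c * u + v) (eval-binomial-suc-0ℚ k) (eval-fromBinomial-suc-0ℚ (suc k) cs) ⟩
  c * 0ℚ + 0ℚ
    ≡⟨ cong (_+ 0ℚ) (ℚ.*-zeroʳ c) ⟩
  0ℚ
    ∎

sumBelow : ℕ → (ℕ → ℕ) → ℕ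
sumBelow zero f = 0
sumBelow (suc n) f = sumBelow n f ℕ.+ f n

syntax sumBelow n (λ i → e) = ∑[ i < n ] e

-- The hockey-stick identity Σ_{m<n} (m choose j) = (n choose j + 1), in binomial coordinates.
toℚ-∑-fromBinomial : ∀ k cs (f : ℕ → ℕ) → (∀ m → toℚ (f m) ≡ eval (fromBinomial k cs) (toℚ m)) →
                     ∀ n → toℚ (∑[ m < n ] f m) ≡ eval (fromBinomial (suc k) cs) (toℚ n)
toℚ-∑-fromBinomial k cs f f≗ zero = sym (eval-fromBinomial-suc-0ℚ k cs)
toℚ-∑-fromBinomial k cs f f≗ (suc n) = begin
  toℚ (∑[ m < n ] f m ℕ.+ f n)
    ≡⟨ toℚ-+ (∑[ m < n ] f m) (f n) ⟩
  toℚ (∑[ m < n ] f m) + toℚ (f n)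
    ≡⟨ cong₂ _+_ (toℚ-∑-fromBinomial k cs f f≗ n) (f≗ n) ⟩
  eval (fromBinomial (suc k) cs) (toℚ n) + eval (fromBinomial k cs) (toℚ n)
    ≡⟨ fromBinomial-pascal k cs (toℚ n) ⟨
  eval (fromBinomial (suc k) cs) (toℚ n + 1ℚ)
    ≡⟨ cong (eval (fromBinomial (suc k) cs)) (trans (ℚ.+-comm (toℚ n) 1ℚ) (sym (toℚ-suc n))) ⟩
  eval (fromBinomial (suc k) cs) (toℚ (suc n))
    ∎

eval-fromBinomial-⊕ : ∀ k cs ds x →
  eval (fromBinomial k (cs ⊕ ds)) x ≡ eval (fromBinomial k cs) x + eval (fromBinomial k ds) x
eval-fromBinomial-⊕ k [] ds x = sym (ℚ.+-identityˡ _)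
eval-fromBinomial-⊕ k (c ∷ cs) [] x = sym (ℚ.+-identityʳ _)
eval-fromBinomial-⊕ k (c ∷ cs) (d ∷ ds) x = begin
  eval (fromBinomial k ((c + d) ∷ (cs ⊕ ds))) x
    ≡⟨ eval-fromBinomial-∷ k (c + d) (cs ⊕ ds) x ⟩
  (c + d) * G + eval (fromBinomial (suc k) (cs ⊕ ds)) x
    ≡⟨ cong ((c + d) * G +_) (eval-fromBinomial-⊕ (suc k) cs ds x) ⟩
  (c + d) * G + (C + D)
    ≡⟨ lemma c d G C D ⟩
  (c * G + C) + (d * G + D)
    ≡⟨ cong₂ _+_ (eval-fromBinomial-∷ k c cs x) (eval-fromBinomial-∷ k d ds x) ⟨
  eval (fromBinomial k (c ∷ cs)) x + eval (fromBinomial k (d ∷ ds)) x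
    ∎
  where
  G = eval (binomial k) x
  C = eval (fromBinomial (suc k) cs) x
  D = eval (fromBinomial (suc k) ds) x
  lemma : ∀ c d g u v → (c + d) * g + (u + v) ≡ (c * g + u) + (d * g + v)
  lemma = solve-∀ ℚ-ring

eval-fromBinomial-scale : ∀ k a cs x → eval (fromBinomial k (scale a cs)) x ≡ a * eval (fromBinomial k cs) x
eval-fromBinomial-scale k a [] x = sym (ℚ.*-zeroʳ a)
eval-fromBinomial-scale k a (c ∷ cs) x = begin
  eval (fromBinomial k ((a * c) ∷ scale a cs)) x
    ≡⟨ eval-fromBinomial-∷ k (a * c) (scale a cs) x ⟩
  (a * c) * G + eval (fromBinomial (suc k) (scale a cs)) x
    ≡⟨ cong ((a * c) * G +_) (eval-fromBinomial-scale (suc k) a cs x) ⟩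
  (a * c) * G + a * C
    ≡⟨ lemma a c G C ⟩
  a * (c * G + C)
    ≡⟨ cong (a *_) (eval-fromBinomial-∷ k c cs x) ⟨
  a * eval (fromBinomial k (c ∷ cs)) x
    ∎
  where
  G = eval (binomial k) x
  C = eval (fromBinomial (suc k) cs) x
  lemma : ∀ a c g u → (a * c) * g + a * u ≡ a * (c * g + u)
  lemma = solve-∀ ℚ-ring

eval-fromBinomial-0∷ : ∀ k cs x → eval (fromBinomial k (0ℚ ∷ cs)) x ≡ eval (fromBinomial (suc k) cs) x
eval-fromBinomial-0∷ k cs x = begin
  eval (fromBinomial k (0ℚ ∷ cs)) x
    ≡⟨ eval-fromBinomial-∷ k 0ℚ cs x ⟩
  0ℚ * eval (binomial k) x + eval (fromBinomial (suc k) cs) x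
    ≡⟨ cong (_+ eval (fromBinomial (suc k) cs) x) (ℚ.*-zeroˡ (eval (binomial k) x)) ⟩
  0ℚ + eval (fromBinomial (suc k) cs) x
    ≡⟨ ℚ.+-identityˡ (eval (fromBinomial (suc k) cs) x) ⟩
  eval (fromBinomial (suc k) cs) x
    ∎

length-scale-binomial : ∀ c k → length (scale c (binomial k)) ≡ suc k
length-scale-binomial c k = trans (length-map (c *_) (binomial k)) (length-binomial k)

length-fromBinomial : ∀ k c cs → length (fromBinomial k (c ∷ cs)) ≡ suc (k ℕ.+ length cs)
scale-binomial-shorter : ∀ k c c′ cs → length (scale c (binomial k)) < length (fromBinomial (suc k) (c′ ∷ cs))
length-fromBinomial k c [] = begin
  length (scale c (binomial k) ⊕ [])  ≡⟨ cong length (⊕-identityʳ (scale c (binomial k))) ⟩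
  length (scale c (binomial k))       ≡⟨ length-scale-binomial c k ⟩
  suc k                               ≡⟨ cong suc (ℕ.+-identityʳ k) ⟨
  suc (k ℕ.+ 0)                       ∎
length-fromBinomial k c (c′ ∷ cs) = begin
  length (scale c (binomial k) ⊕ B)
    ≡⟨ length-⊕ (scale c (binomial k)) B (ℕ.<⇒≤ (scale-binomial-shorter k c c′ cs)) ⟩
  length B
    ≡⟨ length-fromBinomial (suc k) c′ cs ⟩
  suc (suc k ℕ.+ length cs)
    ≡⟨ cong suc (ℕ.+-suc k (length cs)) ⟨
  suc (k ℕ.+ length (c′ ∷ cs))
    ∎
  where B = fromBinomial (suc k) (c′ ∷ cs)

scale-binomial-shorter k c c′ cs =
  subst₂ _<_ (sym (length-scale-binomial c k)) (sym (length-fromBinomial (suc k) c′ cs))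
    (s≤s (ℕ.m≤m+n (suc k) (length cs)))

last-fromBinomial : ∀ k c cs →
  last (fromBinomial k (c ∷ cs)) ≡ Maybe.map (_* binomialLead (k ℕ.+ length cs)) (last (c ∷ cs))
last-fromBinomial k c [] = begin
  last (scale c (binomial k) ⊕ [])             ≡⟨ cong last (⊕-identityʳ (scale c (binomial k))) ⟩
  last (scale c (binomial k))                  ≡⟨ last-map (c *_) (binomial k) ⟩
  Maybe.map (c *_) (last (binomial k))         ≡⟨ cong (Maybe.map (c *_)) (last-binomial k) ⟩
  just (c * binomialLead k)                    ≡⟨ cong (λ i → just (c * binomialLead i)) (ℕ.+-identityʳ k) ⟨
  just (c * binomialLead (k ℕ.+ 0))            ∎
last-fromBinomial k c (c′ ∷ cs) = begin
  last (scale c (binomial k) ⊕ fromBinomial (suc k) (c′ ∷ cs))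
    ≡⟨ last-⊕ (scale c (binomial k)) _ (scale-binomial-shorter k c c′ cs) ⟩
  last (fromBinomial (suc k) (c′ ∷ cs))
    ≡⟨ last-fromBinomial (suc k) c′ cs ⟩
  Maybe.map (_* binomialLead (suc k ℕ.+ length cs)) (last (c′ ∷ cs))
    ≡⟨ cong (λ i → Maybe.map (_* binomialLead i) (last (c′ ∷ cs))) (ℕ.+-suc k (length cs)) ⟨
  Maybe.map (_* binomialLead (k ℕ.+ length (c′ ∷ cs))) (last (c′ ∷ cs))
    ∎

-- the binomial coordinates of n ↦ |P_n^(d+1)|, namely the coefficients of (1 + z) (1 + 2z)^d
walkCoeffs : ℕ → List ℚ
walkCoeffs zero = 1ℚ ∷ 1ℚ ∷ []
walkCoeffs (suc d) = walkCoeffs d ⊕ (0ℚ ∷ scale (toℚ 2) (walkCoeffs d))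

length-walkCoeffs : ∀ d → length (walkCoeffs d) ≡ 2 ℕ.+ d
length-walkCoeffs zero = refl
length-walkCoeffs (suc d) = begin
  length (cs ⊕ (0ℚ ∷ scale (toℚ 2) cs))
    ≡⟨ length-⊕ cs _ (ℕ.m≤n⇒m≤1+n (ℕ.≤-reflexive (sym (length-map _ cs)))) ⟩
  suc (length (scale (toℚ 2) cs))
    ≡⟨ cong suc (length-map _ cs) ⟩
  suc (length cs)
    ≡⟨ cong suc (length-walkCoeffs d) ⟩
  suc (2 ℕ.+ d)
    ≡⟨ ℕ.+-suc 2 d ⟨
  2 ℕ.+ suc d
    ∎
  where cs = walkCoeffs d

last-walkCoeffs : ∀ d → last (walkCoeffs d) ≡ just (toℚ (2 ^ d))
last-walkCoeffs zero = refl
last-walkCoeffs (suc d) with walkCoeffs d | last-walkCoeffs d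
... | c ∷ cs | last≡2^d = begin
  last ((c ∷ cs) ⊕ (0ℚ ∷ scale (toℚ 2) (c ∷ cs)))
    ≡⟨ last-⊕ (c ∷ cs) _ (s≤s (ℕ.≤-reflexive (sym (length-map _ (c ∷ cs))))) ⟩
  last (scale (toℚ 2) (c ∷ cs))
    ≡⟨ last-map (toℚ 2 *_) (c ∷ cs) ⟩
  Maybe.map (toℚ 2 *_) (last (c ∷ cs))
    ≡⟨ cong (Maybe.map (toℚ 2 *_)) last≡2^d ⟩
  just (toℚ 2 * toℚ (2 ^ d))
    ≡⟨ cong just (toℚ-* 2 (2 ^ d)) ⟨
  just (toℚ (2 ^ suc d))
    ∎

-- Walks and the ℓ¹ norm

infixl 6 _+ᵛ_

_+ᵛ_ : ∀ {d} → Point d → Point d → Point d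
_+ᵛ_ = zipWith ℤ._+_

origin : ∀ {d} → Point d
origin = replicate _ (ℤ.+ 0)

+ᵛ-assoc : ∀ {d} (x y z : Point d) → (x +ᵛ y) +ᵛ z ≡ x +ᵛ (y +ᵛ z)
+ᵛ-assoc = zipWith-assoc ℤ.+-assoc

+ᵛ-identityˡ : ∀ {d} (x : Point d) → origin +ᵛ x ≡ x
+ᵛ-identityˡ = zipWith-identityˡ ℤ.+-identityˡ

+ᵛ-identityʳ : ∀ {d} (x : Point d) → x +ᵛ origin ≡ x
+ᵛ-identityʳ = zipWith-identityʳ ℤ.+-identityʳ

∥_∥₁ : ∀ {d} → Point d → ℕ
∥ [] ∥₁ = 0
∥ t ∷ x ∥₁ = ∣ t ∣ ℕ.+ ∥ x ∥₁

∥origin∥₁ : ∀ d → ∥ origin {d} ∥₁ ≡ 0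
∥origin∥₁ zero = refl
∥origin∥₁ (suc d) = ∥origin∥₁ d

InBall : ∀ {d} → ℕ → Point d → Set
InBall n x = Σ ℕ λ k → ∥ x ∥₁ ℕ.+ k ℕ.* 2 ≡ n

sign : Bool → ℤ
sign true = ℤ.+ 1
sign false = -[1+ 0 ]

tabulate-0≡origin : ∀ {d} → Vec.tabulate (λ (_ : Fin d) → ℤ.+ 0) ≡ origin
tabulate-0≡origin = trans (tabulate-cong (λ i → sym (lookup-replicate i (ℤ.+ 0)))) (tabulate∘lookup origin)

stepVec-zero : ∀ {d} s → stepVec {suc d} (Fin.zero , s) ≡ sign s ∷ origin
stepVec-zero true = cong (ℤ.+ 1 ∷_) tabulate-0≡origin
stepVec-zero false = cong (-[1+ 0 ] ∷_) tabulate-0≡origin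

stepVec-zero-+ᵛ : ∀ {d} s t (x : Point d) → stepVec (Fin.zero , s) +ᵛ (t ∷ x) ≡ (sign s ℤ.+ t) ∷ x
stepVec-zero-+ᵛ s t x = trans (cong (_+ᵛ (t ∷ x)) (stepVec-zero s)) (cong (sign s ℤ.+ t ∷_) (+ᵛ-identityˡ x))

Adjacent : ℕ → ℕ → Set
Adjacent m n = m ≡ suc n ⊎ suc m ≡ n

Adjacent-+ˡ : ∀ a {m n} → Adjacent m n → Adjacent (a ℕ.+ m) (a ℕ.+ n)
Adjacent-+ˡ a (inj₁ m≡1+n) = inj₁ (trans (cong (a ℕ.+_) m≡1+n) (ℕ.+-suc a _))
Adjacent-+ˡ a (inj₂ 1+m≡n) = inj₂ (trans (sym (ℕ.+-suc a _)) (cong (a ℕ.+_) 1+m≡n))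

Adjacent-+ʳ : ∀ {m n} a → Adjacent m n → Adjacent (m ℕ.+ a) (n ℕ.+ a)
Adjacent-+ʳ a (inj₁ m≡1+n) = inj₁ (cong (ℕ._+ a) m≡1+n)
Adjacent-+ʳ a (inj₂ 1+m≡n) = inj₂ (cong (ℕ._+ a) 1+m≡n)

∣sign+∣ : ∀ s t → Adjacent ∣ sign s ℤ.+ t ∣ ∣ t ∣
∣sign+∣ true (ℤ.+ m) = inj₁ refl
∣sign+∣ true -[1+ zero ] = inj₂ refl
∣sign+∣ true -[1+ suc m ] = inj₂ refl
∣sign+∣ false (ℤ.+ zero) = inj₁ refl
∣sign+∣ false (ℤ.+ suc m) = inj₂ refl
∣sign+∣ false -[1+ m ] = inj₁ refl

∥step+∥₁ : ∀ {d} (X : Step d) x → Adjacent ∥ stepVec X +ᵛ x ∥₁ ∥ x ∥₁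
∥step+∥₁ (Fin.zero , s) (t ∷ x) =
  subst (λ y → Adjacent ∥ y ∥₁ ∥ t ∷ x ∥₁) (sym (stepVec-zero-+ᵛ s t x))
    (Adjacent-+ʳ ∥ x ∥₁ (∣sign+∣ s t))
∥step+∥₁ (Fin.suc i , s) (t ∷ x) rewrite ℤ.+-identityˡ t = Adjacent-+ˡ ∣ t ∣ (∥step+∥₁ (i , s) x)

walkEnd-InBall : ∀ {d n} (w : Vec (Step d) n) → InBall n (walkEnd w)
walkEnd-InBall {d} [] = 0 , cong (ℕ._+ 0) (∥origin∥₁ d)
walkEnd-InBall (X ∷ w) with walkEnd-InBall w | ∥step+∥₁ X (walkEnd w)
... | k , eq | inj₁ up = k , trans (cong (ℕ._+ k ℕ.* 2) up) (cong suc eq)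
... | k , eq | inj₂ down =
  suc k , trans (lemma ∥ stepVec X +ᵛ walkEnd w ∥₁ k) (cong suc (trans (cong (ℕ._+ k ℕ.* 2) down) eq))
  where
  lemma : ∀ a k → a ℕ.+ suc k ℕ.* 2 ≡ suc (suc a ℕ.+ k ℕ.* 2)
  lemma = solve-∀ ℕ-ring

walkEnd-++ : ∀ {d m n} (u : Vec (Step d) m) (w : Vec (Step d) n) → walkEnd (u Vec.++ w) ≡ walkEnd u +ᵛ walkEnd w
walkEnd-++ [] w = sym (+ᵛ-identityˡ (walkEnd w))
walkEnd-++ (X ∷ u) w =
  trans (cong (stepVec X +ᵛ_) (walkEnd-++ u w)) (sym (+ᵛ-assoc (stepVec X) (walkEnd u) (walkEnd w)))

walkEnd-replicate-up : ∀ {d} m → walkEnd (replicate m (Fin.zero {d} , true)) ≡ ℤ.+ m ∷ origin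
walkEnd-replicate-up zero = refl
walkEnd-replicate-up (suc m) =
  trans (cong (stepVec (Fin.zero , true) +ᵛ_) (walkEnd-replicate-up m)) (stepVec-zero-+ᵛ true (ℤ.+ m) origin)

walkEnd-replicate-down : ∀ {d} m → walkEnd (replicate (suc m) (Fin.zero {d} , false)) ≡ -[1+ m ] ∷ origin
walkEnd-replicate-down zero = stepVec-zero-+ᵛ false (ℤ.+ 0) origin
walkEnd-replicate-down (suc m) =
  trans (cong (stepVec (Fin.zero , false) +ᵛ_) (walkEnd-replicate-down m)) (stepVec-zero-+ᵛ false -[1+ m ] origin)

straightWalk : ∀ {d} t → Σ (Vec (Step (suc d)) ∣ t ∣) λ w → walkEnd w ≡ t ∷ origin
straightWalk (ℤ.+ m) = replicate m (Fin.zero , true) , walkEnd-replicate-up m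
straightWalk -[1+ m ] = replicate (suc m) (Fin.zero , false) , walkEnd-replicate-down m

liftStep : ∀ {d} → Step d → Step (suc d)
liftStep (i , s) = Fin.suc i , s

walkEnd-map-liftStep : ∀ {d n} (w : Vec (Step d) n) → walkEnd (Vec.map liftStep w) ≡ ℤ.+ 0 ∷ walkEnd w
walkEnd-map-liftStep [] = refl
walkEnd-map-liftStep (X ∷ w) = cong (stepVec (liftStep X) +ᵛ_) (walkEnd-map-liftStep w)

walkTo : ∀ {d} (x : Point d) → Σ (Vec (Step d) ∥ x ∥₁) λ w → walkEnd w ≡ x
walkTo [] = [] , refl
walkTo (t ∷ x) with straightWalk t | walkTo x
... | u , u-end | w , w-end = u Vec.++ Vec.map liftStep w , (begin
  walkEnd (u Vec.++ Vec.map liftStep w)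
    ≡⟨ walkEnd-++ u (Vec.map liftStep w) ⟩
  walkEnd u +ᵛ walkEnd (Vec.map liftStep w)
    ≡⟨ cong₂ _+ᵛ_ u-end (trans (walkEnd-map-liftStep w) (cong (ℤ.+ 0 ∷_) w-end)) ⟩
  (t ℤ.+ ℤ.+ 0) ∷ (origin +ᵛ x)
    ≡⟨ cong₂ _∷_ (ℤ.+-identityʳ t) (+ᵛ-identityˡ x) ⟩
  t ∷ x
    ∎)

detour : ∀ {d} k → Vec (Step (suc d)) (k ℕ.* 2)
detour zero = []
detour (suc k) = (Fin.zero , true) ∷ (Fin.zero , false) ∷ detour k

walkEnd-detour : ∀ {d} k → walkEnd (detour {d} k) ≡ origin
walkEnd-detour zero = refl
walkEnd-detour (suc k) = begin
  stepVec (Fin.zero , true) +ᵛ (stepVec (Fin.zero , false) +ᵛ walkEnd (detour k))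
    ≡⟨ cong (λ y → stepVec (Fin.zero , true) +ᵛ (stepVec (Fin.zero , false) +ᵛ y)) (walkEnd-detour k) ⟩
  stepVec (Fin.zero , true) +ᵛ (stepVec (Fin.zero , false) +ᵛ origin)
    ≡⟨ cong (stepVec (Fin.zero , true) +ᵛ_) (stepVec-zero-+ᵛ false (ℤ.+ 0) origin) ⟩
  stepVec (Fin.zero , true) +ᵛ (-[1+ 0 ] ∷ origin)
    ≡⟨ stepVec-zero-+ᵛ true -[1+ 0 ] origin ⟩
  origin
    ∎

InBall⇒InP : ∀ {d n} (x : Point (suc d)) → InBall n x → InP (suc d) n x
InBall⇒InP x (k , refl) with walkTo x
... | w , w-end = w Vec.++ detour k , (begin
  walkEnd (w Vec.++ detour k)               ≡⟨ walkEnd-++ w (detour k) ⟩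
  walkEnd w +ᵛ walkEnd (detour k)       ≡⟨ cong₂ _+ᵛ_ w-end (walkEnd-detour k) ⟩
  x +ᵛ origin                           ≡⟨ +ᵛ-identityʳ x ⟩
  x                                     ∎)

-- Enumerating the points within reach

absAtMost : ℕ → List ℤ
absAtMost zero = ℤ.+ 0 ∷ []
absAtMost (suc n) = ℤ.+ suc n ∷ -[1+ n ] ∷ absAtMost n

∈-absAtMost⁻ : ∀ {t} n → t ∈ absAtMost n → ∣ t ∣ ≤ n
∈-absAtMost⁻ zero (here refl) = z≤n
∈-absAtMost⁻ (suc n) (here refl) = ℕ.≤-refl
∈-absAtMost⁻ (suc n) (there (here refl)) = ℕ.≤-refl
∈-absAtMost⁻ (suc n) (there (there t∈)) = ℕ.m≤n⇒m≤1+n (∈-absAtMost⁻ n t∈)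

∈-absAtMost⁺ : ∀ t n → ∣ t ∣ ≤ n → t ∈ absAtMost n
∈-absAtMost⁺ (ℤ.+ zero) zero _ = here refl
∈-absAtMost⁺ (ℤ.+ m) (suc n) m≤1+n with ℕ.m≤n⇒m<n∨m≡n m≤1+n
... | inj₁ (s≤s m≤n) = there (there (∈-absAtMost⁺ (ℤ.+ m) n m≤n))
... | inj₂ refl = here refl
∈-absAtMost⁺ -[1+ m ] (suc n) m<1+n with ℕ.m≤n⇒m<n∨m≡n m<1+n
... | inj₁ (s≤s m<n) = there (there (∈-absAtMost⁺ -[1+ m ] n m<n))
... | inj₂ refl = there (here refl)

absAtMost-unique : ∀ n → Unique (absAtMost n)
absAtMost-unique zero = All.[] ∷ []
absAtMost-unique (suc n) =
  All.tabulate new₁ ∷ All.tabulate new₂ ∷ absAtMost-unique n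
  where
  new₁ : ∀ {t} → t ∈ -[1+ n ] ∷ absAtMost n → ℤ.+ suc n ≢ t
  new₁ (here ()) refl
  new₁ (there t∈) refl = ℕ.<-irrefl refl (∈-absAtMost⁻ n t∈)
  new₂ : ∀ {t} → t ∈ absAtMost n → -[1+ n ] ≢ t
  new₂ t∈ refl = ℕ.<-irrefl refl (∈-absAtMost⁻ n t∈)

dependentProduct : ∀ {d} → List ℤ → (ℤ → List (Point d)) → List (Point (suc d))
dependentProduct [] f = []
dependentProduct (t ∷ ts) f = List.map (t ∷_) (f t) ++ dependentProduct ts f

∈-dependentProduct⁻ : ∀ {d} ts (f : ℤ → List (Point d)) {t y} →
                      t ∷ y ∈ dependentProduct ts f → t ∈ ts × y ∈ f t
∈-dependentProduct⁻ (t′ ∷ ts) f t∷y∈ with ∈-++⁻ (List.map (t′ ∷_) (f t′)) t∷y∈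
... | inj₁ t∷y∈map with ∈-map⁻ (t′ ∷_) t∷y∈map
...   | y , y∈ , refl = here refl , y∈
∈-dependentProduct⁻ (t′ ∷ ts) f t∷y∈ | inj₂ t∷y∈rest with ∈-dependentProduct⁻ ts f t∷y∈rest
... | t∈ , y∈ = there t∈ , y∈

∈-dependentProduct⁺ : ∀ {d} ts (f : ℤ → List (Point d)) {t y} →
                      t ∈ ts → y ∈ f t → t ∷ y ∈ dependentProduct ts f
∈-dependentProduct⁺ (t ∷ ts) f (here refl) y∈ = ∈-++⁺ˡ (∈-map⁺ (t ∷_) y∈)
∈-dependentProduct⁺ (t′ ∷ ts) f (there t∈) y∈ = ∈-++⁺ʳ (List.map (t′ ∷_) (f t′)) (∈-dependentProduct⁺ ts f t∈ y∈)

dependentProduct-unique : ∀ {d} ts (f : ℤ → List (Point d)) →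
                          Unique ts → (∀ t → Unique (f t)) → Unique (dependentProduct ts f)
dependentProduct-unique [] f _ _ = []
dependentProduct-unique (t ∷ ts) f (t∉ts ∷ ts!) f! =
  Unique.++⁺ (Unique.map⁺ ∷-injectiveʳ (f! t)) (dependentProduct-unique ts f ts! f!) disjoint
  where
  ∷-injectiveʳ : ∀ {d} {x y : Point d} → _≡_ {A = Point (suc d)} (t ∷ x) (t ∷ y) → x ≡ y
  ∷-injectiveʳ refl = refl
  disjoint : ∀ {v} → v ∈ List.map (t ∷_) (f t) × v ∈ dependentProduct ts f → ⊥
  disjoint (v∈map , v∈rest) with ∈-map⁻ (t ∷_) v∈map
  ... | y , _ , refl = All.lookup t∉ts (proj₁ (∈-dependentProduct⁻ ts f v∈rest)) refl

length-dependentProduct-∷ : ∀ {d} t ts (f : ℤ → List (Point d)) →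
  length (dependentProduct (t ∷ ts) f) ≡ length (f t) ℕ.+ length (dependentProduct ts f)
length-dependentProduct-∷ t ts f =
  trans (length-++ (List.map (t ∷_) (f t))) (cong (ℕ._+ _) (length-map (t ∷_) (f t)))

ball : (d n : ℕ) → List (Point d)
ball zero zero = [] ∷ []
ball zero (suc zero) = []
ball zero (suc (suc n)) = ball zero n
ball (suc d) n = dependentProduct (absAtMost n) (λ t → ball d (n ∸ ∣ t ∣))

ball-unique : ∀ d n → Unique (ball d n)
ball-unique zero zero = All.[] ∷ []
ball-unique zero (suc zero) = []
ball-unique zero (suc (suc n)) = ball-unique zero n
ball-unique (suc d) n =
  dependentProduct-unique (absAtMost n) _ (absAtMost-unique n) (λ t → ball-unique d (n ∸ ∣ t ∣))

∈-ball⁻ : ∀ d n {x} → x ∈ ball d n → InBall n x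
∈-ball⁻ zero zero {[]} _ = 0 , refl
∈-ball⁻ zero (suc (suc n)) {[]} []∈ with ∈-ball⁻ zero n []∈
... | k , refl = suc k , refl
∈-ball⁻ (suc d) n {t ∷ y} t∷y∈ with ∈-dependentProduct⁻ (absAtMost n) (λ t → ball d (n ∸ ∣ t ∣)) t∷y∈
... | t∈ , y∈ with ∈-ball⁻ d (n ∸ ∣ t ∣) y∈
... | k , eq = k , (begin
  (∣ t ∣ ℕ.+ ∥ y ∥₁) ℕ.+ k ℕ.* 2   ≡⟨ ℕ.+-assoc ∣ t ∣ ∥ y ∥₁ (k ℕ.* 2) ⟩
  ∣ t ∣ ℕ.+ (∥ y ∥₁ ℕ.+ k ℕ.* 2)   ≡⟨ cong (∣ t ∣ ℕ.+_) eq ⟩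
  ∣ t ∣ ℕ.+ (n ∸ ∣ t ∣)            ≡⟨ ℕ.m+[n∸m]≡n (∈-absAtMost⁻ n t∈) ⟩
  n                                ∎)

∈-ball⁺ : ∀ d n {x} → InBall n x → x ∈ ball d n
∈-ball⁺ zero _ {[]} (zero , refl) = here refl
∈-ball⁺ zero _ {[]} (suc k , refl) = ∈-ball⁺ zero _ (k , refl)
∈-ball⁺ (suc d) n {t ∷ y} (k , eq) =
  ∈-dependentProduct⁺ (absAtMost n) (λ t → ball d (n ∸ ∣ t ∣))
    (∈-absAtMost⁺ t n ∣t∣≤n) (∈-ball⁺ d (n ∸ ∣ t ∣) (k , sym n∸∣t∣≡))
  where
  eq′ : ∣ t ∣ ℕ.+ (∥ y ∥₁ ℕ.+ k ℕ.* 2) ≡ n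
  eq′ = trans (sym (ℕ.+-assoc ∣ t ∣ ∥ y ∥₁ (k ℕ.* 2))) eq
  ∣t∣≤n : ∣ t ∣ ≤ n
  ∣t∣≤n = subst (∣ t ∣ ≤_) eq′ (ℕ.m≤m+n ∣ t ∣ _)
  n∸∣t∣≡ : n ∸ ∣ t ∣ ≡ ∥ y ∥₁ ℕ.+ k ℕ.* 2
  n∸∣t∣≡ = trans (cong (_∸ ∣ t ∣) (sym eq′)) (ℕ.m+n∸m≡n ∣ t ∣ _)

-- Counting walk positions

-- Splitting off the first coordinate t leaves a budget n - |t|, and each |t| ≥ 1 occurs twice.
length-ball-suc : ∀ d n → length (ball (suc d) n) ≡ length (ball d n) ℕ.+ 2 ℕ.* ∑[ m < n ] length (ball d m)
length-ball-suc d n = begin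
  length (ball (suc d) n)
    ≡⟨ lemma (length (ball (suc d) n)) ⟩
  length (ball (suc d) n) ℕ.+ 2 ℕ.* 0
    ≡⟨ cong (λ i → length (ball (suc d) n) ℕ.+ 2 ℕ.* ∑[ j < i ] c j) (ℕ.n∸n≡0 n) ⟨
  length (ball (suc d) n) ℕ.+ 2 ℕ.* ∑[ j < n ∸ n ] c j
    ≡⟨ layers n ℕ.≤-refl ⟩
  c n ℕ.+ 2 ℕ.* ∑[ m < n ] c m
    ∎
  where
  c : ℕ → ℕ
  c m = length (ball d m)
  f : ℤ → List (Point d)
  f t = ball d (n ∸ ∣ t ∣)
  lemma : ∀ a → a ≡ a ℕ.+ 2 ℕ.* 0
  lemma = solve-∀ ℕ-ring
  layers : ∀ m → m ≤ n → length (dependentProduct (absAtMost m) f) ℕ.+ 2 ℕ.* ∑[ j < n ∸ m ] c j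
                         ≡ c n ℕ.+ 2 ℕ.* ∑[ j < n ] c j
  layers zero _ = cong (ℕ._+ 2 ℕ.* ∑[ j < n ] c j) (trans (length-dependentProduct-∷ _ [] f) (ℕ.+-identityʳ (c n)))
  layers (suc m) m<n = begin
    length (dependentProduct (absAtMost (suc m)) f) ℕ.+ 2 ℕ.* ∑[ j < n ∸ suc m ] c j
      ≡⟨ cong (ℕ._+ 2 ℕ.* ∑[ j < n ∸ suc m ] c j) (trans (length-dependentProduct-∷ (ℤ.+ suc m) (-[1+ m ] ∷ absAtMost m) f)
           (cong (c (n ∸ suc m) ℕ.+_) (length-dependentProduct-∷ -[1+ m ] (absAtMost m) f))) ⟩
    (c (n ∸ suc m) ℕ.+ (c (n ∸ suc m) ℕ.+ L)) ℕ.+ 2 ℕ.* ∑[ j < n ∸ suc m ] c j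
      ≡⟨ regroup (c (n ∸ suc m)) L (∑[ j < n ∸ suc m ] c j) ⟩
    L ℕ.+ 2 ℕ.* ∑[ j < suc (n ∸ suc m) ] c j
      ≡⟨ cong (λ i → L ℕ.+ 2 ℕ.* ∑[ j < i ] c j) (ℕ.+-∸-assoc 1 m<n) ⟨
    L ℕ.+ 2 ℕ.* ∑[ j < n ∸ m ] c j
      ≡⟨ layers m (ℕ.<⇒≤ m<n) ⟩
    c n ℕ.+ 2 ℕ.* ∑[ j < n ] c j
      ∎
    where
    L = length (dependentProduct (absAtMost m) f)
    regroup : ∀ a l s → (a ℕ.+ (a ℕ.+ l)) ℕ.+ 2 ℕ.* s ≡ l ℕ.+ 2 ℕ.* (s ℕ.+ a)
    regroup = solve-∀ ℕ-ring

length-ball-zero-parity : ∀ n → length (ball 0 n) ℕ.+ length (ball 0 (suc n)) ≡ 1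
length-ball-zero-parity zero = refl
length-ball-zero-parity (suc zero) = refl
length-ball-zero-parity (suc (suc n)) = length-ball-zero-parity n

length-ball-one : ∀ n → length (ball 1 n) ≡ suc n
length-ball-one n = trans (length-ball-suc 0 n) (go n)
  where
  c : ℕ → ℕ
  c m = length (ball 0 m)
  go : ∀ n → c n ℕ.+ 2 ℕ.* ∑[ m < n ] c m ≡ suc n
  go zero = refl
  go (suc n) = begin
    c (suc n) ℕ.+ 2 ℕ.* (∑[ m < n ] c m ℕ.+ c n)          ≡⟨ regroup (c (suc n)) (c n) (∑[ m < n ] c m) ⟩
    (c n ℕ.+ c (suc n)) ℕ.+ (c n ℕ.+ 2 ℕ.* ∑[ m < n ] c m) ≡⟨ cong₂ ℕ._+_ (length-ball-zero-parity n) (go n) ⟩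
    suc (suc n)                                           ∎
    where
    regroup : ∀ a b s → a ℕ.+ 2 ℕ.* (s ℕ.+ b) ≡ (b ℕ.+ a) ℕ.+ (b ℕ.+ 2 ℕ.* s)
    regroup = solve-∀ ℕ-ring

HasCard-unique : ∀ {A : Set} {S : A → Set} {k₁ k₂} → HasCard S k₁ → HasCard S k₂ → k₁ ≡ k₂
HasCard-unique (xs , xs! , xs⇔S , refl) (ys , ys! , ys⇔S , refl) =
  ↭-length (∼bag⇒↭ (unique∧set⇒bag xs! ys! λ {x} → ⇔.trans (xs⇔S x) (⇔.sym (ys⇔S x))))

ball-HasCard : ∀ d n → HasCard (InP (suc d) n) (length (ball (suc d) n))
ball-HasCard d n =
  ball (suc d) n , ball-unique (suc d) n ,
  (λ x → mk⇔ (λ x∈ → InBall⇒InP x (∈-ball⁻ (suc d) n x∈))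
             (λ { (w , refl) → ∈-ball⁺ (suc d) n (walkEnd-InBall w) })) ,
  refl

CountsWalkPositions-agree : ∀ {d} P Q → CountsWalkPositions d P → CountsWalkPositions d Q →
                            ∀ n → eval P (toℚ n) ≡ eval Q (toℚ n)
CountsWalkPositions-agree P Q P-counts Q-counts n with P-counts n | Q-counts n
... | k , k-card , toℚk≡P[n] | l , l-card , toℚl≡Q[n] = begin
  eval P (toℚ n)   ≡⟨ toℚk≡P[n] ⟨
  toℚ k            ≡⟨ cong toℚ (HasCard-unique k-card l-card) ⟩
  toℚ l            ≡⟨ toℚl≡Q[n] ⟩
  eval Q (toℚ n)   ∎

walkPoly : ℕ → Poly
walkPoly d = fromBinomial 0 (walkCoeffs d)

eval-walkPoly-zero : ∀ x → eval (walkPoly 0) x ≡ 1ℚ + x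
eval-walkPoly-zero x = begin
  eval (walkPoly 0) x
    ≡⟨ eval-fromBinomial-∷ 0 1ℚ (1ℚ ∷ []) x ⟩
  1ℚ * eval (binomial 0) x + eval (fromBinomial 1 (1ℚ ∷ [])) x
    ≡⟨ cong (1ℚ * eval (binomial 0) x +_) (eval-fromBinomial-∷ 1 1ℚ [] x) ⟩
  1ℚ * eval (binomial 0) x + (1ℚ * eval (binomial 1) x + 0ℚ)
    ≡⟨ cong₂ (λ u v → 1ℚ * u + (v + 0ℚ)) (eval-binomial-zero x) (eval-binomial-suc 0 x) ⟩
  1ℚ * 1ℚ + (eval (binomial 0) x * (x - 0ℚ) + 0ℚ)
    ≡⟨ cong (λ u → 1ℚ * 1ℚ + (u * (x - 0ℚ) + 0ℚ)) (eval-binomial-zero x) ⟩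
  1ℚ * 1ℚ + (1ℚ * (x - 0ℚ) + 0ℚ)
    ≡⟨ lemma x ⟩
  1ℚ + x
    ∎
  where
  lemma : ∀ x → 1ℚ * 1ℚ + (1ℚ * (x - 0ℚ) + 0ℚ) ≡ 1ℚ + x
  lemma = solve-∀ ℚ-ring

toℚ-length-ball : ∀ d n → toℚ (length (ball (suc d) n)) ≡ eval (walkPoly d) (toℚ n)
toℚ-length-ball zero n = begin
  toℚ (length (ball 1 n))      ≡⟨ cong toℚ (length-ball-one n) ⟩
  toℚ (suc n)                  ≡⟨ toℚ-suc n ⟩
  1ℚ + toℚ n                   ≡⟨ eval-walkPoly-zero (toℚ n) ⟨
  eval (walkPoly 0) (toℚ n)    ∎
toℚ-length-ball (suc d) n = begin
  toℚ (length (ball (2 ℕ.+ d) n))                                     ≡⟨ cong toℚ (length-ball-suc (suc d) n) ⟩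
  toℚ (c n ℕ.+ 2 ℕ.* S)
    ≡⟨ trans (toℚ-+ (c n) (2 ℕ.* S)) (cong (toℚ (c n) +_) (toℚ-* 2 S)) ⟩
  toℚ (c n) + toℚ 2 * toℚ S
    ≡⟨ cong₂ (λ u v → u + toℚ 2 * v) (toℚ-length-ball d n) (toℚ-∑-fromBinomial 0 cs c (toℚ-length-ball d) n) ⟩
  eval (fromBinomial 0 cs) x + toℚ 2 * eval (fromBinomial 1 cs) x
    ≡⟨ cong (eval (fromBinomial 0 cs) x +_) (eval-fromBinomial-scale 1 (toℚ 2) cs x) ⟨
  eval (fromBinomial 0 cs) x + eval (fromBinomial 1 (scale (toℚ 2) cs)) x
    ≡⟨ cong (eval (fromBinomial 0 cs) x +_) (eval-fromBinomial-0∷ 0 (scale (toℚ 2) cs) x) ⟨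
  eval (fromBinomial 0 cs) x + eval (fromBinomial 0 (0ℚ ∷ scale (toℚ 2) cs)) x
    ≡⟨ eval-fromBinomial-⊕ 0 cs (0ℚ ∷ scale (toℚ 2) cs) x ⟨
  eval (walkPoly (suc d)) x
    ∎
  where
  c : ℕ → ℕ
  c m = length (ball (suc d) m)
  S = ∑[ m < n ] c m
  cs = walkCoeffs d
  x = toℚ n

walkPoly-counts : ∀ d → CountsWalkPositions (suc d) (walkPoly d)
walkPoly-counts d n = length (ball (suc d) n) , ball-HasCard d n , toℚ-length-ball d n

length-walkPoly : ∀ d → length (walkPoly d) ≡ 2 ℕ.+ d
length-walkPoly d with walkCoeffs d | length-walkCoeffs d
... | c ∷ cs | len≡ = trans (length-fromBinomial 0 c cs) len≡

last-walkPoly : ∀ d → last (walkPoly d) ≡ just (toℚ (2 ^ d) * binomialLead (suc d))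
last-walkPoly d with walkCoeffs d | length-walkCoeffs d | last-walkCoeffs d
... | c ∷ cs | len≡ | last≡2^d = begin
  last (fromBinomial 0 (c ∷ cs))
    ≡⟨ last-fromBinomial 0 c cs ⟩
  Maybe.map (_* binomialLead (length cs)) (last (c ∷ cs))
    ≡⟨ cong₂ (λ i l → Maybe.map (_* binomialLead i) l) (ℕ.suc-injective len≡) last≡2^d ⟩
  just (toℚ (2 ^ d) * binomialLead (suc d))
    ∎

walkPoly-Normalized : ∀ d → Normalized (walkPoly d)
walkPoly-Normalized d last≡0 =
  *-binomialLead-≢0 (suc d) (toℚ-≢0 (ℕ.≢-nonZero⁻¹ (2 ^ d) {{ℕ.m^n≢0 2 d}}))
    (just-injective (trans (sym (last-walkPoly d)) last≡0))

mainTheorem5 : (d : ℕ) → d ≥ 1 →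
  Σ Poly λ Q →
    (Normalized Q × CountsWalkPositions d Q)
    × (∀ Q′ → Normalized Q′ → CountsWalkPositions d Q′ → Q′ ≡ Q)
    × HasDegree Q d
    × leadingCoeff Q ≡ just (leadTarget d)
mainTheorem5 (suc d) _ =
  walkPoly d , (walkPoly-Normalized d , walkPoly-counts d) ,
  (λ Q Q-normalized Q-counts → Normalized-eval-injective Q (walkPoly d) Q-normalized (walkPoly-Normalized d)
                                  (CountsWalkPositions-agree Q (walkPoly d) Q-counts (walkPoly-counts d))) ,
  length-walkPoly d ,
  trans (last-walkPoly d) (cong just (toℚ-*-binomialLead (2 ^ d) (suc d)))
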